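{- Let $n\ge1$ and let $T$ be a domino tiling of the Aztec diamond $AD(n)$ that is invariant under the reflection $x\mapsto -x$. Let $V_0\subseteq\{v_1,\dots,v_{2n}\}$ be the set of ending points of the corresponding family of half Delannoy paths. Then for each $i\in\{1,\dots,n\}$, the $i$-th diagonal cell contains exactly one complete domino of $T$ (i.e. is assigned $0$) if and only if either both $v_{2i-1},v_{2i}\in V_0$ or both $v_{2i-1},v_{2i}\notin V_0$.
   Context: $AD(n)$ is the union of the closed unit squares $[a,a+1]\times[b,b+1]$ ($a,b\in\mathbb{Z}$) with $|a+\tfrac12|+|b+\tfrac12|\le n$; refer to such a square by its lower-left corner $(a,b)$, and color it black if $a+b\equiv n-1\pmod 2$, white otherwise. For a black square $(a,b)$ let $m(a,b)=(a,b+\tfrac12)$ be the midpoint of its left edge. Put $v_{2i-1}=m(-1,2i-n-2)$ and $v_{2i}=m(0,2i-n-1)$ for $i=1,\dots,n$. The $i$-th diagonal cell is the $2\times2$ block of squares $(-1,2i-n-2),(0,2i-n-1),(-1,2i-n-1),(0,2i-n-2)$; a domino is completely contained in it if both of its squares belong to it; the cell is assigned $1,0,-1$ according as it contains $2,1,0$ complete dominoes. Path bijection: each domino of $T$ that is horizontal with black left square $(a,b)$ gives a step from $m(a,b)$ to $m(a+2,b)$; each vertical domino with black top square $(a,b)$ gives a step from $m(a,b)$ to $m(a+1,b-1)$; each vertical domino with black bottom square $(a,b)$ gives a step from $m(a,b)$ to $m(a+1,b+1)$; horizontal dominoes with black right square give no step. These steps form $n$ non-intersecting lattice paths, each symmetric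 under $x\mapsto-x$. The left half of such a path ends at $v_{2i}$ if the path passes through $v_{2i}$, and ends at $v_{2i-1}$ if the path crosses the line $x=0$ by the step from $v_{2i-1}$ to $m(1,2i-n-2)$ (i.e. $T$ contains the horizontal domino formed by squares $(-1,2i-n-2)$ and $(0,2i-n-2)$). $V_0$ is the set of these $n$ endpoints. -}

module Defs where

open import Data.Nat as ℕ using (ℕ; _≤_)
open import Data.Integer as ℤ using (ℤ; +_; -[1+_]; _+_; _-_; _*_; ∣_∣)
open import Data.Integer.Divisibility using (_∣_)
open import Data.Bool using (Bool; true)
open import Data.Product using (Σ; ∃; _×_; _,_)
open import Data.Sum using (_⊎_)
open import Relation.Binary.PropositionalEquality using (_≡_)

-- A unit square [a,a+1]×[b,b+1] is referred to by its lower-left corner (a,b).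
Square : Set
Square = ℤ × ℤ

-- AD(n): |a+1/2| + |b+1/2| ≤ n, i.e. |2a+1| + |2b+1| ≤ 2n.
InAD : ℕ → Square → Set
InAD n (a , b) = ∣ + 2 * a + + 1 ∣ ℕ.+ ∣ + 2 * b + + 1 ∣ ≤ 2 ℕ.* n

Black : ℕ → Square → Set
Black n (a , b) = + 2 ∣ (a + b - (+ n - + 1))

data Orient : Set where
  hor vert : Orient

record Domino : Set where
  constructor dom
  field
    x : ℤ
    y : ℤ
    o : Orient

sq₁ : Domino → Square
sq₁ (dom a b _) = (a , b)

sq₂ : Domino → Square
sq₂ (dom a b hor)  = (a + + 1 , b)
sq₂ (dom a b vert) = (a , b + + 1)

Covers : Domino → Square → Set
Covers d s = (s ≡ sq₁ d) ⊎ (s ≡ sq₂ d)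

record Tiling (n : ℕ) : Set where
  field
    has    : Domino → Bool
    inside : ∀ d → has d ≡ true → InAD n (sq₁ d) × InAD n (sq₂ d)
    cover  : ∀ s → InAD n s →
             Σ Domino λ d → (has d ≡ true) × Covers d s ×
               (∀ d' → has d' ≡ true → Covers d' s → d' ≡ d)
open Tiling public

-- Reflection x ↦ -x maps square (a,b) to (-a-1,b).
reflSq : Square → Square
reflSq (a , b) = (ℤ.- a - + 1 , b)

-- Reflected domino (horizontal (a,b),(a+1,b) ↦ (-a-2,b),(-a-1,b)).
reflDom : Domino → Domino
reflDom (dom a b hor)  = dom (ℤ.- a - + 2) b hor
reflDom (dom a b vert) = dom (ℤ.- a - + 1) b vert

Symmetric : ∀ {n} → Tiling n → Set
Symmetric T = ∀ d → has T (reflDom d) ≡ has T d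

-- A point m(a,b) (midpoint of the left edge of square (a,b)) is represented by (a,b).
Point : Set
Point = ℤ × ℤ

Step : ℕ → Domino → Point → Point → Set
Step n (dom a b hor) p q =
  Black n (a , b) × (p ≡ (a , b)) × (q ≡ (a + + 2 , b))
Step n (dom a b vert) p q =
  (Black n (a , b + + 1) × (p ≡ (a , b + + 1)) × (q ≡ (a + + 1 , b)))
  ⊎ (Black n (a , b) × (p ≡ (a , b)) × (q ≡ (a + + 1 , b + + 1)))

Passes : ∀ {n} → Tiling n → Point → Set
Passes {n} T p = Σ Domino λ d → (has T d ≡ true) ×
  (Σ Point λ q → Step n d p q ⊎ Step n d q p)

row : ℕ → ℕ → ℤ
row n i = + (2 ℕ.* i) - + n - + 2

vOdd : ℕ → ℕ → Point
vOdd n i = (ℤ.- + 1 , row n i)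

vEven : ℕ → ℕ → Point
vEven n i = (+ 0 , row n i + + 1)

Crosses : ∀ {n} → Tiling n → ℕ → Set
Crosses {n} T i = has T (dom (ℤ.- + 1) (row n i) hor) ≡ true

InRange : ℕ → ℕ → Set
InRange n j = (1 ≤ j) × (j ≤ n)

InV₀ : ∀ {n} → Tiling n → Point → Set
InV₀ {n} T p =
  (Σ ℕ λ j → InRange n j × (p ≡ vEven n j) × Passes T p)
  ⊎ (Σ ℕ λ j → InRange n j × (p ≡ vOdd n j) × Crosses T j)

InCell : ℕ → ℕ → Square → Set
InCell n i s =
  (s ≡ (ℤ.- + 1 , row n i)) ⊎ (s ≡ (+ 0 , row n i + + 1))
  ⊎ (s ≡ (ℤ.- + 1 , row n i + + 1)) ⊎ (s ≡ (+ 0 , row n i))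

CompletelyIn : ℕ → ℕ → Domino → Set
CompletelyIn n i d = InCell n i (sq₁ d) × InCell n i (sq₂ d)

ExactlyOneInCell : ∀ {n} → Tiling n → ℕ → Set
ExactlyOneInCell {n} T i =
  Σ Domino λ d → (has T d ≡ true) × CompletelyIn n i d ×
    (∀ d' → has T d' ≡ true → CompletelyIn n i d' → d' ≡ d)

-- Only four dominoes fit completely in a diagonal cell: its bottom and top
-- horizontals and its two verticals.  A horizontal overlaps both verticals, and
-- the reflection swaps the verticals, so the cell holds exactly one complete
-- domino iff exactly one of its two horizontals is a tile.  On the path side,
-- v₂ᵢ₋₁ ∈ V₀ says that the bottom horizontal is a tile.  The square of v₂ᵢ is
-- black, and a black square carries a path through the midpoint of its left
-- edge unless it is the right half of a horizontal domino; so v₂ᵢ ∈ V₀ says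
-- that the top horizontal is not a tile.
module Submission where

open import Defs
open import Data.Nat using (ℕ; _≤_)
open import Data.Product using (_×_)
open import Data.Sum using (_⊎_)
open import Relation.Nullary using (¬_)
open import Function.Bundles using (_⇔_)

open import Data.Bool using (Bool; true; false)
open import Data.Bool.Properties using (not-¬; ¬-not)
open import Data.Integer as ℤ using (ℤ; +_; -[1+_]; _+_; _-_; _*_; ∣_∣)
open import Data.Integer.Properties
  using (pos-+; pos-*; +-assoc; +-identityʳ; ∣i-j∣≤∣i∣+∣j∣; ∣-i∣≡∣i∣; +-0-abelianGroup)
open import Algebra.Properties.AbelianGroup +-0-abelianGroup using (∙-cancelˡ; ∙-cancelʳ)
open import Data.Integer.Tactic.RingSolver using (solve-∀)
open import Data.List using (_∷_; [])
open import Data.Nat as ℕ using (suc; s≤s)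
open import Data.Nat.Divisibility using (_∣_; m∣m*n)
open import Data.Nat.Properties using (m≤n⇒∃[o]m+o≡n; module ≤-Reasoning)
import Data.Nat.Tactic.RingSolver as ℕ-Solver
open import Data.Product using (Σ; _,_; proj₁; proj₂)
open import Data.Sum using (inj₁; inj₂)
open import Function.Base using (case_of_)
open import Function.Bundles using (mk⇔; module Equivalence)
open import Function.Properties.Equivalence using () renaming (trans to ⇔-trans)
open import Relation.Binary.PropositionalEquality
open import Relation.Nullary using (contradiction)

x+1≢x : ∀ x → x + + 1 ≢ x
x+1≢x x eq = contradiction (∙-cancelˡ x (+ 1) (+ 0) (trans eq (sym (+-identityʳ x)))) λ ()

x+1+1≢x : ∀ x → x + + 1 + + 1 ≢ x
x+1+1≢x x eq = contradiction (∙-cancelˡ x (+ 2) (+ 0) x+2≡x+0) λ ()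
  where
  x+2≡x+0 : x + + 2 ≡ x + + 0
  x+2≡x+0 = trans (sym (+-assoc x (+ 1) (+ 1))) (trans eq (sym (+-identityʳ x)))

shift-injective : ∀ {x y a b : ℤ} → (x + + 1 , y) ≡ (a + + 1 , b) → (x , y) ≡ (a , b)
shift-injective {x} {a = a} eq = cong₂ _,_ (∙-cancelʳ (+ 1) x a (cong proj₁ eq)) (cong proj₂ eq)

row-top : ∀ k m → row (suc k ℕ.+ m) (suc k) + + 1 ≡ + k - + m
row-top k m = begin
  + (2 ℕ.* suc k) - + (suc k ℕ.+ m) - + 2 + + 1
    ≡⟨ cong₂ (λ x y → x - y - + 2 + + 1) (pos-* 2 (suc k)) (pos-+ (suc k) m) ⟩
  + 2 * + suc k - (+ suc k + + m) - + 2 + + 1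
    ≡⟨ cong (λ x → + 2 * x - (x + + m) - + 2 + + 1) (pos-+ 1 k) ⟩
  + 2 * (+ 1 + + k) - (+ 1 + + k + + m) - + 2 + + 1
    ≡⟨ ring (+ k) (+ m) ⟩
  + k - + m ∎
  where
  open ≡-Reasoning
  ring : ∀ K M → + 2 * (+ 1 + K) - (+ 1 + K + M) - + 2 + + 1 ≡ K - M
  ring = solve-∀

vEven-square-inAD : ∀ {n i} → 1 ≤ i → i ≤ n → InAD n (+ 0 , row n i + + 1)
vEven-square-inAD {i = suc k} (s≤s _) i≤n with m≤n⇒∃[o]m+o≡n i≤n
... | m , refl = begin
  suc ∣ + 2 * (row (suc k ℕ.+ m) (suc k) + + 1) + + 1 ∣
    ≡⟨ cong (λ x → suc ∣ + 2 * x + + 1 ∣) (row-top k m) ⟩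
  suc ∣ + 2 * (+ k - + m) + + 1 ∣
    ≡⟨ cong (λ x → suc ∣ x ∣) doubled ⟩
  suc ∣ + suc (2 ℕ.* k) - + (2 ℕ.* m) ∣
    ≤⟨ s≤s (∣i-j∣≤∣i∣+∣j∣ (+ suc (2 ℕ.* k)) (+ (2 ℕ.* m))) ⟩
  suc (suc (2 ℕ.* k) ℕ.+ 2 ℕ.* m)
    ≡⟨ ℕ-Solver.solve (k ∷ m ∷ []) ⟩
  2 ℕ.* (suc k ℕ.+ m) ∎
  where
  open ≤-Reasoning
  ring : ∀ K M → + 2 * (K - M) + + 1 ≡ + 1 + + 2 * K - + 2 * M
  ring = solve-∀
  doubled : + 2 * (+ k - + m) + + 1 ≡ + suc (2 ℕ.* k) - + (2 ℕ.* m)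
  doubled = trans (ring (+ k) (+ m))
    (sym (cong₂ _-_ (trans (pos-+ 1 (2 ℕ.* k)) (cong (_+_ (+ 1)) (pos-* 2 k))) (pos-* 2 m)))

vEven-square-black : ∀ {n i} → 1 ≤ i → i ≤ n → Black n (+ 0 , row n i + + 1)
vEven-square-black {i = suc k} (s≤s _) i≤n with m≤n⇒∃[o]m+o≡n i≤n
... | m , refl =
  subst (2 ∣_) (sym (trans (cong ∣_∣ parity) (∣-i∣≡∣i∣ (+ (2 ℕ.* m))))) (m∣m*n m)
  where
  ring : ∀ K M → + 0 + (K - M) - (+ 1 + K + M - + 1) ≡ ℤ.- (+ 2 * M)
  ring = solve-∀
  parity : + 0 + (row (suc k ℕ.+ m) (suc k) + + 1) - (+ (suc k ℕ.+ m) - + 1) ≡ ℤ.- + (2 ℕ.* m)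
  parity = begin
    + 0 + (row (suc k ℕ.+ m) (suc k) + + 1) - (+ (suc k ℕ.+ m) - + 1)
      ≡⟨ cong₂ (λ x y → + 0 + x - (y - + 1)) (row-top k m) pos-n ⟩
    + 0 + (+ k - + m) - (+ 1 + + k + + m - + 1)
      ≡⟨ ring (+ k) (+ m) ⟩
    ℤ.- (+ 2 * + m)
      ≡⟨ cong ℤ.-_ (pos-* 2 m) ⟨
    ℤ.- + (2 ℕ.* m) ∎
    where
    open ≡-Reasoning
    pos-n : + (suc k ℕ.+ m) ≡ + 1 + + k + + m
    pos-n = trans (pos-+ (suc k) m) (cong (_+ + m) (pos-+ 1 k))

module _ {n : ℕ} (T : Tiling n) where

  tile⇒covered-inAD : ∀ {d s} → has T d ≡ true → Covers d s → InAD n s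
  tile⇒covered-inAD d∈T (inj₁ refl) = proj₁ (inside T _ d∈T)
  tile⇒covered-inAD d∈T (inj₂ refl) = proj₂ (inside T _ d∈T)

  tile-unique : ∀ {d d' s} → has T d ≡ true → has T d' ≡ true →
                Covers d s → Covers d' s → d ≡ d'
  tile-unique d∈T d'∈T c c' with cover T _ (tile⇒covered-inAD d∈T c)
  ... | _ , _ , _ , unique = trans (unique _ d∈T c) (sym (unique _ d'∈T c'))

step⇒covers-source : ∀ {n} d {p q} → Step n d p q → Covers d p
step⇒covers-source (dom a b hor)  (_ , refl , _)        = inj₁ refl
step⇒covers-source (dom a b vert) (inj₁ (_ , refl , _)) = inj₂ refl
step⇒covers-source (dom a b vert) (inj₂ (_ , refl , _)) = inj₁ refl

step⇒covers-left-of-target : ∀ {n} d {p x y} → Step n d p (x + + 1 , y) → Covers d (x , y)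
step⇒covers-left-of-target (dom a b hor)  (_ , _ , eq) =
  inj₂ (shift-injective (trans eq (cong (_, b) (sym (+-assoc a (+ 1) (+ 1))))))
step⇒covers-left-of-target (dom a b vert) (inj₁ (_ , _ , eq)) = inj₁ (shift-injective eq)
step⇒covers-left-of-target (dom a b vert) (inj₂ (_ , _ , eq)) = inj₂ (shift-injective eq)

black⇒step⊎right-of-horizontal : ∀ {n} d {s} → Covers d s → Black n s →
  (Σ Point λ q → Step n d s q)
  ⊎ (Σ ℤ λ a → Σ ℤ λ b → d ≡ dom a b hor × s ≡ (a + + 1 , b))
black⇒step⊎right-of-horizontal (dom a b hor)  (inj₁ refl) black = inj₁ (_ , black , refl , refl)
black⇒step⊎right-of-horizontal (dom a b hor)  (inj₂ refl) _     = inj₂ (a , b , refl , refl)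
black⇒step⊎right-of-horizontal (dom a b vert) (inj₁ refl) black =
  inj₁ (_ , inj₂ (black , refl , refl))
black⇒step⊎right-of-horizontal (dom a b vert) (inj₂ refl) black =
  inj₁ (_ , inj₁ (black , refl , refl))

no-step-from-right-of-horizontal : ∀ {n a b q} → ¬ Step n (dom a b hor) (a + + 1 , b) q
no-step-from-right-of-horizontal {a = a} (_ , eq , _) = x+1≢x a (cong proj₁ eq)

no-step-into-right-of-horizontal : ∀ {n a b q} → ¬ Step n (dom a b hor) q (a + + 1 , b)
no-step-into-right-of-horizontal {a = a} (_ , _ , eq) =
  contradiction (∙-cancelˡ a (+ 1) (+ 2) (cong proj₁ eq)) λ ()

module _ {n : ℕ} (T : Tiling n) {a b : ℤ} where

  passes⇒horizontal∉ : Passes T (a + + 1 , b) → has T (dom a b hor) ≢ true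
  passes⇒horizontal∉ (d , d∈T , q , inj₁ step) h∈T
    with tile-unique T d∈T h∈T (step⇒covers-source d step) (inj₂ refl)
  ... | refl = no-step-from-right-of-horizontal {n} step
  passes⇒horizontal∉ (d , d∈T , q , inj₂ step) h∈T
    with tile-unique T d∈T h∈T (step⇒covers-left-of-target d step) (inj₁ refl)
  ... | refl = no-step-into-right-of-horizontal {n} step

  horizontal∉⇒passes : InAD n (a + + 1 , b) → Black n (a + + 1 , b) →
    has T (dom a b hor) ≡ false → Passes T (a + + 1 , b)
  horizontal∉⇒passes inAD black h∉T with cover T _ inAD
  ... | d , d∈T , covers , _ with black⇒step⊎right-of-horizontal d covers black
  ... | inj₁ (q , step) = d , d∈T , q , inj₁ step
  ... | inj₂ (_ , _ , refl , eq) = contradiction h∉T (not-¬ h∈T)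
    where
    h∈T : has T (dom a b hor) ≡ true
    h∈T = subst (λ (x , y) → has T (dom x y hor) ≡ true) (sym (shift-injective eq)) d∈T

  passes⇔horizontal∉ : InAD n (a + + 1 , b) → Black n (a + + 1 , b) →
    Passes T (a + + 1 , b) ⇔ has T (dom a b hor) ≡ false
  passes⇔horizontal∉ inAD black =
    mk⇔ (λ p → ¬-not (passes⇒horizontal∉ p)) (horizontal∉⇒passes inAD black)

cellBottom cellTop cellLeft cellRight : ℤ → Domino
cellBottom r = dom -[1+ 0 ] r hor
cellTop    r = dom -[1+ 0 ] (r + + 1) hor
cellLeft   r = dom -[1+ 0 ] r vert
cellRight  r = dom (+ 0) r vert

inCell-column : ∀ {n i a b} → InCell n i (a , b) → a ≡ -[1+ 0 ] ⊎ a ≡ + 0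
inCell-column (inj₁ refl)               = inj₁ refl
inCell-column (inj₂ (inj₁ refl))        = inj₂ refl
inCell-column (inj₂ (inj₂ (inj₁ refl))) = inj₁ refl
inCell-column (inj₂ (inj₂ (inj₂ refl))) = inj₂ refl

inCell-row : ∀ {n i a b} → InCell n i (a , b) → b ≡ row n i ⊎ b ≡ row n i + + 1
inCell-row (inj₁ refl)               = inj₁ refl
inCell-row (inj₂ (inj₁ refl))        = inj₂ refl
inCell-row (inj₂ (inj₂ (inj₁ refl))) = inj₂ refl
inCell-row (inj₂ (inj₂ (inj₂ refl))) = inj₁ refl

completelyIn-cases : ∀ n i d → CompletelyIn n i d →
  let r = row n i in d ≡ cellBottom r ⊎ d ≡ cellTop r ⊎ d ≡ cellLeft r ⊎ d ≡ cellRight r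
completelyIn-cases n i (dom a b hor) (s₁ , s₂)
  with inCell-column {n} {i} s₁ | inCell-column {n} {i} s₂ | inCell-row {n} {i} s₁
... | inj₁ refl | _      | inj₁ refl = inj₁ refl
... | inj₁ refl | _      | inj₂ refl = inj₂ (inj₁ refl)
... | inj₂ refl | inj₁ () | _
... | inj₂ refl | inj₂ () | _
completelyIn-cases n i (dom a b vert) (s₁ , s₂)
  with inCell-column {n} {i} s₁ | inCell-row {n} {i} s₁ | inCell-row {n} {i} s₂
... | inj₁ refl | inj₁ refl | _      = inj₂ (inj₂ (inj₁ refl))
... | inj₂ refl | inj₁ refl | _      = inj₂ (inj₂ (inj₂ refl))
... | _         | inj₂ refl | inj₁ eq = contradiction eq (x+1+1≢x (row n i))
... | _         | inj₂ refl | inj₂ eq = contradiction eq (x+1≢x (row n i + + 1))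

module _ {n : ℕ} (T : Tiling n) (i : ℕ) where

  private
    r : ℤ
    r = row n i

    bottom-complete : CompletelyIn n i (cellBottom r)
    bottom-complete = inj₁ refl , inj₂ (inj₂ (inj₂ refl))

    top-complete : CompletelyIn n i (cellTop r)
    top-complete = inj₂ (inj₂ (inj₁ refl)) , inj₂ (inj₁ refl)

    left-complete : CompletelyIn n i (cellLeft r)
    left-complete = inj₁ refl , inj₂ (inj₂ (inj₁ refl))

    right-complete : CompletelyIn n i (cellRight r)
    right-complete = inj₂ (inj₂ (inj₂ refl)) , inj₂ (inj₁ refl)

  only-bottom⇒exactlyOne : has T (cellBottom r) ≡ true → has T (cellTop r) ≡ false →
                           ExactlyOneInCell T i
  only-bottom⇒exactlyOne bottom∈T top∉T =
    cellBottom r , bottom∈T , bottom-complete , unique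
    where
    unique : ∀ d → has T d ≡ true → CompletelyIn n i d → d ≡ cellBottom r
    unique d d∈T complete with completelyIn-cases n i d complete
    ... | inj₁ eq                 = eq
    ... | inj₂ (inj₁ refl)        = contradiction top∉T (not-¬ d∈T)
    -- The verticals overlap the bottom horizontal; tile-unique turns that into the goal.
    ... | inj₂ (inj₂ (inj₁ refl)) = tile-unique T d∈T bottom∈T (inj₁ refl) (inj₁ refl)
    ... | inj₂ (inj₂ (inj₂ refl)) = tile-unique T d∈T bottom∈T (inj₁ refl) (inj₂ refl)

  only-top⇒exactlyOne : has T (cellTop r) ≡ true → has T (cellBottom r) ≡ false →
                        ExactlyOneInCell T i
  only-top⇒exactlyOne top∈T bottom∉T =
    cellTop r , top∈T , top-complete , unique
    where
    unique : ∀ d → has T d ≡ true → CompletelyIn n i d → d ≡ cellTop r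
    unique d d∈T complete with completelyIn-cases n i d complete
    ... | inj₁ refl               = contradiction bottom∉T (not-¬ d∈T)
    ... | inj₂ (inj₁ eq)          = eq
    ... | inj₂ (inj₂ (inj₁ refl)) = tile-unique T d∈T top∈T (inj₂ refl) (inj₁ refl)
    ... | inj₂ (inj₂ (inj₂ refl)) = tile-unique T d∈T top∈T (inj₂ refl) (inj₂ refl)

  both-horizontal⇒¬exactlyOne : has T (cellBottom r) ≡ true → has T (cellTop r) ≡ true →
                                ¬ ExactlyOneInCell T i
  both-horizontal⇒¬exactlyOne bottom∈T top∈T (_ , _ , _ , unique) =
    x+1≢x r (sym (cong Domino.y bottom≡top))
    where
    bottom≡top : cellBottom r ≡ cellTop r
    bottom≡top = trans (unique _ bottom∈T bottom-complete) (sym (unique _ top∈T top-complete))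

  no-horizontal⇒¬exactlyOne : Symmetric T →
                              has T (cellBottom r) ≡ false → has T (cellTop r) ≡ false →
                              ¬ ExactlyOneInCell T i
  no-horizontal⇒¬exactlyOne symmetric bottom∉T top∉T (d , d∈T , complete , unique)
    with completelyIn-cases n i d complete
  ... | inj₁ refl               = contradiction bottom∉T (not-¬ d∈T)
  ... | inj₂ (inj₁ refl)        = contradiction top∉T (not-¬ d∈T)
  ... | inj₂ (inj₂ (inj₁ refl)) = case unique _ (trans right≡left d∈T) right-complete of λ ()
    where right≡left = symmetric (cellLeft r)
  ... | inj₂ (inj₂ (inj₂ refl)) = case unique _ (trans (sym right≡left) d∈T) left-complete of λ ()
    where right≡left = symmetric (cellLeft r)

  exactlyOne⇔horizontals-differ : Symmetric T →
                                  ExactlyOneInCell T i ⇔ (has T (cellBottom r) ≢ has T (cellTop r))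
  exactlyOne⇔horizontals-differ symmetric = mk⇔ to from
    where
    to : ExactlyOneInCell T i → has T (cellBottom r) ≢ has T (cellTop r)
    to one with has T (cellBottom r) in bottom | has T (cellTop r) in top
    ... | true  | true  = λ _ → both-horizontal⇒¬exactlyOne bottom top one
    ... | false | false = λ _ → no-horizontal⇒¬exactlyOne symmetric bottom top one
    ... | true  | false = λ ()
    ... | false | true  = λ ()
    from : has T (cellBottom r) ≢ has T (cellTop r) → ExactlyOneInCell T i
    from differ with has T (cellBottom r) in bottom | has T (cellTop r) in top
    ... | true  | false = only-bottom⇒exactlyOne bottom top
    ... | false | true  = only-top⇒exactlyOne top bottom
    ... | true  | true  = contradiction refl differ
    ... | false | false = contradiction refl differ

module _ {n : ℕ} (T : Tiling n) {i : ℕ} (i∈[1,n] : InRange n i) where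

  inV₀-vOdd⇔crosses : InV₀ T (vOdd n i) ⇔ Crosses T i
  inV₀-vOdd⇔crosses = mk⇔ to (λ crosses → inj₂ (i , i∈[1,n] , refl , crosses))
    where
    to : InV₀ T (vOdd n i) → Crosses T i
    to (inj₁ (_ , _ , () , _))
    to (inj₂ (_ , _ , eq , crosses)) =
      subst (λ y → has T (cellBottom y) ≡ true) (sym (cong proj₂ eq)) crosses

  inV₀-vEven⇔passes : InV₀ T (vEven n i) ⇔ Passes T (vEven n i)
  inV₀-vEven⇔passes = mk⇔ to (λ passes → inj₁ (i , i∈[1,n] , refl , passes))
    where
    to : InV₀ T (vEven n i) → Passes T (vEven n i)
    to (inj₁ (_ , _ , _ , passes)) = passes
    to (inj₂ (_ , _ , () , _))

  inV₀-vEven⇔top∉ : InV₀ T (vEven n i) ⇔ has T (cellTop (row n i)) ≡ false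
  inV₀-vEven⇔top∉ = ⇔-trans inV₀-vEven⇔passes
    (passes⇔horizontal∉ T (vEven-square-inAD 1≤i i≤n) (vEven-square-black 1≤i i≤n))
    where
    1≤i = proj₁ i∈[1,n]
    i≤n = proj₂ i∈[1,n]

open Equivalence using (to; from)

differ⇔agree : ∀ {P Q : Set} {b c : Bool} → P ⇔ (b ≡ true) → Q ⇔ (c ≡ false) →
  (b ≢ c) ⇔ ((P × Q) ⊎ (¬ P × ¬ Q))
differ⇔agree {b = true}  {false} P⇔ Q⇔ =
  mk⇔ (λ _ → inj₁ (from P⇔ refl , from Q⇔ refl)) (λ _ ())
differ⇔agree {b = false} {true}  P⇔ Q⇔ =
  mk⇔ (λ _ → inj₂ ((λ p → case to P⇔ p of λ ()) , (λ q → case to Q⇔ q of λ ()))) (λ _ ())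
differ⇔agree {b = true}  {true}  P⇔ Q⇔ = mk⇔ (λ differ → contradiction refl differ) λ
  { (inj₁ (_ , q))  → case to Q⇔ q of λ ()
  ; (inj₂ (¬p , _)) → contradiction (from P⇔ refl) ¬p }
differ⇔agree {b = false} {false} P⇔ Q⇔ = mk⇔ (λ differ → contradiction refl differ) λ
  { (inj₁ (p , _))  → case to P⇔ p of λ ()
  ; (inj₂ (_ , ¬q)) → contradiction (from Q⇔ refl) ¬q }

lemma2p1 : (n : ℕ) → 1 ≤ n → (T : Tiling n) → Symmetric T →
    (i : ℕ) → 1 ≤ i → i ≤ n →
    ExactlyOneInCell T i ⇔
      ((InV₀ T (vOdd n i) × InV₀ T (vEven n i))
        ⊎ (¬ InV₀ T (vOdd n i) × ¬ InV₀ T (vEven n i)))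
lemma2p1 n _ T symmetric i 1≤i i≤n =
  ⇔-trans (exactlyOne⇔horizontals-differ T i symmetric)
          (differ⇔agree (inV₀-vOdd⇔crosses T i∈[1,n]) (inV₀-vEven⇔top∉ T i∈[1,n]))
  where
  i∈[1,n] : InRange n i
  i∈[1,n] = 1≤i , i≤n
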